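{- Let $\mathcal{M}$ be the set of Motzkin meanders that contain neither $UD$ nor $DD$ as a contiguous subword, and let $S(u)=\sum_{w\in\mathcal{M}} z^{|w|}u^{\mathrm{level}(w)}$. Put $$W=\sqrt{1-2z+z^2-4z^3},\qquad r_1=\frac{1-z-W}{2z}.$$ Then $$S(u)=\frac{r_1}{z(z-ur_1)},$$ and for every $j\ge0$ the generating function of the meanders in $\mathcal{M}$ ending at level $j$ is $[u^j]S(u)=\frac1z\Big(\frac{r_1}{z}\Big)^{j+1}$.
   Context: A Motzkin meander is a finite word $w$ over $\{U,H,D\}$ (heights $+1,0,-1$) all of whose prefixes have nonnegative height sum; $|w|$ is its length and $\mathrm{level}(w)$ its total height sum; the empty word is included; excursions are meanders of level $0$. "Contains $XY$ as a contiguous subword" means two consecutive letters are $X$ then $Y$. Generating functions are formal power series in $z$; $W$ is the formal power series square root with constant term $1$; $[u^j]$ is coefficient extraction. -}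

module Defs where

open import Data.Bool using (Bool; true; false; if_then_else_; _∧_; not; _∨_)
open import Data.Nat as ℕ using (ℕ; zero; suc; _∸_; _≡ᵇ_)
open import Data.Integer as ℤ using (ℤ; +_; 0ℤ)
open import Data.Rational as ℚ using (ℚ; 0ℚ; 1ℚ; ½; _+_; _*_; _-_; -_)
open import Data.List using (List; []; _∷_; length; filter; concatMap; inits)
open import Relation.Nullary.Decidable using (⌊_⌋)
open import Data.Bool.Properties using (T?)
open import Data.Bool using (T)

data Step : Set where
  U H D : Step

height : Step → ℤ
height U = + 1
height H = 0ℤ
height D = ℤ.-[1+ 0 ]

level : List Step → ℤ
level [] = 0ℤ
level (s ∷ w) = height s ℤ.+ level w

allB : {A : Set} → (A → Bool) → List A → Bool
allB p [] = true
allB p (x ∷ xs) = p x ∧ allB p xs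

isMeander : List Step → Bool
isMeander w = allB (λ p → 0ℤ ℤ.≤ᵇ level p) (inits w)

eqStep : Step → Step → Bool
eqStep U U = true
eqStep H H = true
eqStep D D = true
eqStep _ _ = false

containsPair : Step → Step → List Step → Bool
containsPair X Y [] = false
containsPair X Y (a ∷ []) = false
containsPair X Y (a ∷ b ∷ w) = (eqStep a X ∧ eqStep b Y) ∨ containsPair X Y (b ∷ w)

inM : List Step → Bool
inM w = isMeander w ∧ not (containsPair U D w) ∧ not (containsPair D D w)

words : ℕ → List (List Step)
words zero = [] ∷ []
words (suc n) = concatMap (λ w → (U ∷ w) ∷ (H ∷ w) ∷ (D ∷ w) ∷ []) (words n)

count : ℕ → ℕ → ℕ
count n j = length (filter (λ w → T? (inM w ∧ ⌊ level w ℤ.≟ + j ⌋)) (words n))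

Series : Set
Series = ℕ → ℚ

-- Series in z and u: S n j = coefficient of z^n u^j
Series2 : Set
Series2 = ℕ → ℕ → ℚ

fromℕ : ℕ → ℚ
fromℕ n = + n ℚ./ 1

sumTo : ℕ → (ℕ → ℚ) → ℚ
sumTo zero f = f 0
sumTo (suc n) f = sumTo n f + f (suc n)

sumFrom1 : ℕ → (ℕ → ℚ) → ℚ
sumFrom1 zero f = 0ℚ
sumFrom1 (suc n) f = sumFrom1 n f + f (suc n)

_⊕_ : Series → Series → Series
(f ⊕ g) n = f n + g n

_⊖_ : Series → Series → Series
(f ⊖ g) n = f n - g n

_⊛_ : Series → Series → Series
(f ⊛ g) n = sumTo n (λ k → f k * g (n ∸ k))

one : Series
one n = if n ≡ᵇ 0 then 1ℚ else 0ℚ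

zS : Series
zS n = if n ≡ᵇ 1 then 1ℚ else 0ℚ

scale : ℚ → Series → Series
scale c f n = c * f n

pow : Series → ℕ → Series
pow f zero = one
pow f (suc k) = f ⊛ pow f k

P : Series
P = ((one ⊖ scale (fromℕ 2) zS) ⊕ pow zS 2) ⊖ scale (fromℕ 4) (pow zS 3)

-- W = formal square root of P with constant term 1, by the standard
-- coefficient recursion  W_0 = 1,
--   W_n = (P_n - Σ_{k=1}^{n-1} W_k W_{n-k}) / 2   (n ≥ 1).
-- sqrtUpTo n agrees with W on indices ≤ n.
sqrtUpTo : ℕ → Series
sqrtUpTo zero k = if k ≡ᵇ 0 then 1ℚ else 0ℚ
sqrtUpTo (suc n) k =
  if k ≡ᵇ suc n
  then ½ * (P (suc n) - sumFrom1 n (λ i → sqrtUpTo n i * sqrtUpTo n (suc n ∸ i)))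
  else sqrtUpTo n k

W : Series
W n = sqrtUpTo n n

-- r₁ = (1 - z - W) / (2z).  The numerator has constant term 1 - 1 - W_0 ... = 0
-- (W_0 = 1 definitionally), so division by z is the coefficient shift.
numer : Series
numer = (one ⊖ zS) ⊖ W

r₁ : Series
r₁ n = ½ * numer (suc n)

_⊖₂_ : Series2 → Series2 → Series2
(f ⊖₂ g) n j = f n j - g n j

_⊛₂_ : Series2 → Series2 → Series2
(f ⊛₂ g) n j = sumTo n (λ a → sumTo j (λ b → f a b * g (n ∸ a) (j ∸ b)))

lift : Series → Series2
lift f n j = if j ≡ᵇ 0 then f n else 0ℚ

uVar : Series2
uVar n j = if n ≡ᵇ 0 then (if j ≡ᵇ 1 then 1ℚ else 0ℚ) else 0ℚ

S : Series2
S n j = fromℕ (count n j)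

coeffU : ℕ → Series2 → Series
coeffU j F n = F n j

denomS : Series2
denomS = lift zS ⊛₂ (lift zS ⊖₂ (uVar ⊛₂ lift r₁))

-- Reading a word from left to right, membership in 𝓜 is decided by an automaton that
-- remembers the current height and the last letter (a D may only follow an H).  Sorting
-- words by their last letter gives, for a(n, j) = count n j, the recurrence
--   a(n+1, j) = a(n, j-1) + a(n, j) + a(n-1, j+1).
-- The series r₁ starts at z² and solves r₁ = z (z + r₁ + r₁²), so the coefficient of
-- z^(n+j+2) in r₁^(j+1) = r₁ · r₁^j obeys the same recurrence with the same initial values;
-- hence z^(j+2) [u^j] S = r₁^(j+1).  Comparing consecutive levels gives
-- z² [u^(j+1)] S = z r₁ [u^j] S, which is z (z - u r₁) S = r₁ read off coefficientwise.

module Submission where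

open import Defs
open import Data.Nat as ℕ using (ℕ; zero; suc; _∸_; _≤_; _<_; z≤n; s≤s)
import Data.Nat.Properties as ℕ
open import Relation.Binary.PropositionalEquality

module SeriesAlgebra where

  open import Data.Rational using (ℚ; 0ℚ; _+_; _*_; -_)
  import Data.Rational.Properties as ℚ
  open import Data.Rational.Solver using (module +-*-Solver)
  open +-*-Solver using (solve; _:+_; _:=_)
  open import Relation.Nullary using (yes; no)
  open import Relation.Binary.Reasoning.Setoid (ℕ →-setoid ℚ) using () renaming
    (begin_ to begin≗_; step-≈-⟩ to step-≗-⟩; step-≈-⟨ to step-≗-⟨; _∎ to _∎≗)

  sumTo-cong : ∀ n {f g : ℕ → ℚ} → (∀ k → k ≤ n → f k ≡ g k) → sumTo n f ≡ sumTo n g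
  sumTo-cong zero    f≡g = f≡g 0 z≤n
  sumTo-cong (suc n) f≡g =
    cong₂ _+_ (sumTo-cong n (λ k k≤n → f≡g k (ℕ.m≤n⇒m≤1+n k≤n))) (f≡g (suc n) ℕ.≤-refl)

  sumTo-zero : ∀ n {f : ℕ → ℚ} → (∀ k → k ≤ n → f k ≡ 0ℚ) → sumTo n f ≡ 0ℚ
  sumTo-zero n f≡0 = trans (sumTo-cong n f≡0) (zeros n)
    where
    zeros : ∀ n → sumTo n (λ _ → 0ℚ) ≡ 0ℚ
    zeros zero    = refl
    zeros (suc n) = trans (cong (_+ 0ℚ) (zeros n)) (ℚ.+-identityʳ 0ℚ)

  sumTo-head : ∀ n {f : ℕ → ℚ} → (∀ k → f (suc k) ≡ 0ℚ) → sumTo n f ≡ f 0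
  sumTo-head zero    _    = refl
  sumTo-head (suc n) {f} tail≡0 =
    trans (cong₂ _+_ (sumTo-head n tail≡0) (tail≡0 n)) (ℚ.+-identityʳ (f 0))

  sumTo-+ : ∀ n (f g : ℕ → ℚ) → sumTo n (λ k → f k + g k) ≡ sumTo n f + sumTo n g
  sumTo-+ zero    f g = refl
  sumTo-+ (suc n) f g = trans (cong (_+ (f (suc n) + g (suc n))) (sumTo-+ n f g))
    (solve 4 (λ a b c d → (a :+ b) :+ (c :+ d) := (a :+ c) :+ (b :+ d)) refl
      (sumTo n f) (sumTo n g) (f (suc n)) (g (suc n)))

  sumTo-*ˡ : ∀ n (c : ℚ) (f : ℕ → ℚ) → sumTo n (λ k → c * f k) ≡ c * sumTo n f
  sumTo-*ˡ zero    c f = refl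
  sumTo-*ˡ (suc n) c f = trans (cong (_+ (c * f (suc n))) (sumTo-*ˡ n c f))
    (sym (ℚ.*-distribˡ-+ c (sumTo n f) (f (suc n))))

  sumTo-*ʳ : ∀ n (c : ℚ) (f : ℕ → ℚ) → sumTo n (λ k → f k * c) ≡ sumTo n f * c
  sumTo-*ʳ n c f = trans (sumTo-cong n (λ k _ → ℚ.*-comm (f k) c))
    (trans (sumTo-*ˡ n c f) (ℚ.*-comm c (sumTo n f)))

  sumTo-neg : ∀ n (f : ℕ → ℚ) → sumTo n (λ k → - f k) ≡ - sumTo n f
  sumTo-neg zero    f = refl
  sumTo-neg (suc n) f = trans (cong (_+ (- f (suc n))) (sumTo-neg n f))
    (sym (ℚ.neg-distrib-+ (sumTo n f) (f (suc n))))

  sumTo-suc : ∀ n (f : ℕ → ℚ) → sumTo (suc n) f ≡ f 0 + sumTo n (λ k → f (suc k))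
  sumTo-suc zero    f = refl
  sumTo-suc (suc n) f = trans (cong (_+ f (suc (suc n))) (sumTo-suc n f)) (ℚ.+-assoc (f 0) _ _)

  sumTo-reverse : ∀ n (f : ℕ → ℚ) → sumTo n f ≡ sumTo n (λ k → f (n ∸ k))
  sumTo-reverse zero    f = refl
  sumTo-reverse (suc n) f = begin
    sumTo (suc n) f                          ≡⟨ sumTo-suc n f ⟩
    f 0 + sumTo n (λ k → f (suc k))          ≡⟨ cong (f 0 +_) (sumTo-reverse n (λ k → f (suc k))) ⟩
    f 0 + sumTo n (λ k → f (suc (n ∸ k)))    ≡⟨ ℚ.+-comm (f 0) _ ⟩
    sumTo n (λ k → f (suc (n ∸ k))) + f 0
      ≡⟨ cong₂ _+_ (sumTo-cong n (λ k k≤n → cong f (sym (ℕ.+-∸-assoc 1 k≤n)))) (cong f (sym (ℕ.n∸n≡0 n))) ⟩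
    sumTo (suc n) (λ k → f (suc n ∸ k))      ∎
    where open ≡-Reasoning

  sumTo-triangle : ∀ n (a : ℕ → ℕ → ℚ) →
    sumTo n (λ k → sumTo (n ∸ k) (a k)) ≡ sumTo n (λ m → sumTo m (λ k → a k (m ∸ k)))
  sumTo-triangle zero    a = refl
  sumTo-triangle (suc n) a = begin
    sumTo n (λ k → sumTo (suc n ∸ k) (a k)) + sumTo (suc n ∸ suc n) (a (suc n))
      ≡⟨ cong₂ _+_ (sumTo-cong n (λ k k≤n → cong (λ t → sumTo t (a k)) (ℕ.+-∸-assoc 1 k≤n)))
                   (cong (λ t → sumTo t (a (suc n))) (ℕ.n∸n≡0 n)) ⟩
    sumTo n (λ k → sumTo (n ∸ k) (a k) + a k (suc (n ∸ k))) + a (suc n) 0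
      ≡⟨ cong (_+ a (suc n) 0) (sumTo-+ n _ _) ⟩
    (sumTo n (λ k → sumTo (n ∸ k) (a k)) + sumTo n (λ k → a k (suc (n ∸ k)))) + a (suc n) 0
      ≡⟨ ℚ.+-assoc (sumTo n (λ k → sumTo (n ∸ k) (a k))) _ _ ⟩
    sumTo n (λ k → sumTo (n ∸ k) (a k)) + (sumTo n (λ k → a k (suc (n ∸ k))) + a (suc n) 0)
      ≡⟨ cong₂ _+_ (sumTo-triangle n a)
           (cong₂ _+_ (sumTo-cong n (λ k k≤n → cong (a k) (sym (ℕ.+-∸-assoc 1 k≤n))))
                      (cong (a (suc n)) (sym (ℕ.n∸n≡0 n)))) ⟩
    sumTo n (λ m → sumTo m (λ k → a k (m ∸ k))) + sumTo (suc n) (λ k → a k (suc n ∸ k)) ∎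
    where open ≡-Reasoning

  ⊛-cong : ∀ {f f′ g g′} → f ≗ f′ → g ≗ g′ → f ⊛ g ≗ f′ ⊛ g′
  ⊛-cong f≗f′ g≗g′ n = sumTo-cong n (λ k _ → cong₂ _*_ (f≗f′ k) (g≗g′ (n ∸ k)))

  ⊛-congˡ : ∀ f {g g′} → g ≗ g′ → f ⊛ g ≗ f ⊛ g′
  ⊛-congˡ f = ⊛-cong {f} {f} (λ _ → refl)

  ⊛-congʳ : ∀ g {f f′} → f ≗ f′ → f ⊛ g ≗ f′ ⊛ g
  ⊛-congʳ g f≗f′ = ⊛-cong {g = g} {g} f≗f′ (λ _ → refl)

  ⊛-comm : ∀ f g → f ⊛ g ≗ g ⊛ f
  ⊛-comm f g n = trans (sumTo-reverse n _) (sumTo-cong n (λ k k≤n →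
    trans (cong (λ t → f (n ∸ k) * g t) (ℕ.m∸[m∸n]≡n k≤n)) (ℚ.*-comm (f (n ∸ k)) (g k))))

  ⊛-assoc : ∀ f g h → (f ⊛ g) ⊛ h ≗ f ⊛ (g ⊛ h)
  ⊛-assoc f g h n = begin
    sumTo n (λ m → sumTo m (λ k → f k * g (m ∸ k)) * h (n ∸ m))
      ≡⟨ sumTo-cong n (λ m _ → sym (sumTo-*ʳ m _ _)) ⟩
    sumTo n (λ m → sumTo m (λ k → f k * g (m ∸ k) * h (n ∸ m)))
      ≡⟨ sumTo-cong n (λ m _ → sumTo-cong m (λ k k≤m → cong (λ t → f k * g (m ∸ k) * h t) (∸-∸ k≤m))) ⟩
    sumTo n (λ m → sumTo m (λ k → f k * g (m ∸ k) * h (n ∸ k ∸ (m ∸ k))))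
      ≡⟨ sumTo-triangle n (λ k l → f k * g l * h (n ∸ k ∸ l)) ⟨
    sumTo n (λ k → sumTo (n ∸ k) (λ l → f k * g l * h (n ∸ k ∸ l)))
      ≡⟨ sumTo-cong n (λ k _ → trans (sumTo-cong (n ∸ k) (λ l _ → ℚ.*-assoc (f k) (g l) _))
                                     (sumTo-*ˡ (n ∸ k) (f k) _)) ⟩
    sumTo n (λ k → f k * sumTo (n ∸ k) (λ l → g l * h (n ∸ k ∸ l))) ∎
    where
    open ≡-Reasoning
    ∸-∸ : ∀ {k m} → k ≤ m → n ∸ m ≡ n ∸ k ∸ (m ∸ k)
    ∸-∸ {k} {m} k≤m = trans (cong (n ∸_) (sym (ℕ.m+[n∸m]≡n k≤m))) (sym (ℕ.∸-+-assoc n k (m ∸ k)))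

  ⊛-distribʳ-⊕ : ∀ f g h → (f ⊕ g) ⊛ h ≗ (f ⊛ h) ⊕ (g ⊛ h)
  ⊛-distribʳ-⊕ f g h n =
    trans (sumTo-cong n (λ k _ → ℚ.*-distribʳ-+ (h (n ∸ k)) (f k) (g k))) (sumTo-+ n _ _)

  neg : Series → Series
  neg f n = - f n

  ⊛-negˡ : ∀ f g → neg f ⊛ g ≗ neg (f ⊛ g)
  ⊛-negˡ f g n =
    trans (sumTo-cong n (λ k _ → sym (ℚ.neg-distribˡ-* (f k) (g (n ∸ k))))) (sumTo-neg n _)

  ⊛-negʳ : ∀ f g → f ⊛ neg g ≗ neg (f ⊛ g)
  ⊛-negʳ f g n = trans (⊛-comm f (neg g) n) (trans (⊛-negˡ g f n) (cong -_ (⊛-comm g f n)))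

  ⊛-identityˡ : ∀ f → one ⊛ f ≗ f
  ⊛-identityˡ f n = trans (sumTo-head n (λ k → ℚ.*-zeroˡ (f (n ∸ suc k)))) (ℚ.*-identityˡ (f n))

  ⊛-identityʳ : ∀ f → f ⊛ one ≗ f
  ⊛-identityʳ f n = trans (⊛-comm f one n) (⊛-identityˡ f n)

  shift₁ : Series → Series
  shift₁ f zero    = 0ℚ
  shift₁ f (suc n) = f n

  shift : ℕ → Series → Series
  shift zero    f = f
  shift (suc k) f = shift₁ (shift k f)

  shift₁-cong : ∀ {f g} → f ≗ g → shift₁ f ≗ shift₁ g
  shift₁-cong f≗g zero    = refl
  shift₁-cong f≗g (suc n) = f≗g n

  shift-cong : ∀ k {f g} → f ≗ g → shift k f ≗ shift k g
  shift-cong zero    f≗g = f≗g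
  shift-cong (suc k) f≗g = shift₁-cong (shift-cong k f≗g)

  shift-+ : ∀ k f m → shift k f (k ℕ.+ m) ≡ f m
  shift-+ zero    f m = refl
  shift-+ (suc k) f m = shift-+ k f m

  shift-unique : ∀ k {f g} → (∀ n → n < k → g n ≡ 0ℚ) → (∀ m → g (k ℕ.+ m) ≡ f m) → shift k f ≗ g
  shift-unique zero    _   high n       = sym (high n)
  shift-unique (suc k) low high zero    = sym (low 0 (s≤s z≤n))
  shift-unique (suc k) low high (suc n) = shift-unique k (λ n n<k → low (suc n) (s≤s n<k)) high n

  shift-injective : ∀ k {f g} → shift k f ≗ shift k g → f ≗ g
  shift-injective k {f} {g} eq m = trans (sym (shift-+ k f m)) (trans (eq (k ℕ.+ m)) (shift-+ k g m))

  zS-⊛ : ∀ f → zS ⊛ f ≗ shift₁ f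
  zS-⊛ f zero    = ℚ.*-zeroˡ (f 0)
  zS-⊛ f (suc n) = trans (sumTo-suc n _)
    (trans (cong₂ _+_ (ℚ.*-zeroˡ (f (suc n))) (⊛-identityˡ f n)) (ℚ.+-identityˡ (f n)))

  pow-zS-⊛ : ∀ k f → pow zS k ⊛ f ≗ shift k f
  pow-zS-⊛ zero    f = ⊛-identityˡ f
  pow-zS-⊛ (suc k) f = begin≗
    (zS ⊛ pow zS k) ⊛ f    ≈⟨ ⊛-assoc zS (pow zS k) f ⟩
    zS ⊛ (pow zS k ⊛ f)    ≈⟨ zS-⊛ (pow zS k ⊛ f) ⟩
    shift₁ (pow zS k ⊛ f)  ≈⟨ shift₁-cong (pow-zS-⊛ k f) ⟩
    shift (suc k) f        ∎≗

  ⊛-shift : ∀ k f g → f ⊛ shift k g ≗ shift k (f ⊛ g)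
  ⊛-shift k f g = begin≗
    f ⊛ shift k g          ≈⟨ ⊛-congˡ f (pow-zS-⊛ k g) ⟨
    f ⊛ (pow zS k ⊛ g)     ≈⟨ ⊛-assoc f (pow zS k) g ⟨
    (f ⊛ pow zS k) ⊛ g     ≈⟨ ⊛-congʳ g (⊛-comm f (pow zS k)) ⟩
    (pow zS k ⊛ f) ⊛ g     ≈⟨ ⊛-assoc (pow zS k) f g ⟩
    pow zS k ⊛ (f ⊛ g)     ≈⟨ pow-zS-⊛ k (f ⊛ g) ⟩
    shift k (f ⊛ g)        ∎≗

  pow-zS : ∀ k → pow zS k ≗ shift k one
  pow-zS k n = trans (sym (⊛-identityʳ (pow zS k) n)) (pow-zS-⊛ k one n)

  pow-vanishes : ∀ {f : Series} d → (∀ i → i < d → f i ≡ 0ℚ) →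
                 ∀ k n → n < k ℕ.* d → pow f k n ≡ 0ℚ
  pow-vanishes {f} d low≡0 (suc k) n n<d+kd = sumTo-zero n term≡0
    where
    term≡0 : ∀ i → i ≤ n → f i * pow f k (n ∸ i) ≡ 0ℚ
    term≡0 i i≤n with i ℕ.<? d
    ... | yes i<d = trans (cong (_* pow f k (n ∸ i)) (low≡0 i i<d)) (ℚ.*-zeroˡ (pow f k (n ∸ i)))
    ... | no  i≮d = trans (cong (f i *_) (pow-vanishes d low≡0 k (n ∸ i) rest<)) (ℚ.*-zeroʳ (f i))
      where
      open ℕ.≤-Reasoning
      rest< : n ∸ i < k ℕ.* d
      rest< = ℕ.+-cancelˡ-< d (n ∸ i) (k ℕ.* d) (begin-strict
        d ℕ.+ (n ∸ i)  ≤⟨ ℕ.+-monoˡ-≤ (n ∸ i) (ℕ.≮⇒≥ i≮d) ⟩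
        i ℕ.+ (n ∸ i)  ≡⟨ ℕ.m+[n∸m]≡n i≤n ⟩
        n              <⟨ n<d+kd ⟩
        d ℕ.+ k ℕ.* d  ∎)

module SeriesR₁ where

  open import Data.Bool using (true; false)
  open import Data.Sum using (inj₁; inj₂)
  open import Data.Rational using (ℚ; 0ℚ; ½; _+_; _*_; _-_; -_)
  import Data.Rational.Properties as ℚ
  open import Data.Rational.Solver using (module +-*-Solver)
  open +-*-Solver using (solve; _:+_; _:*_; :-_; _:-_; _:=_; con)
  open SeriesAlgebra

  ≡ᵇ-refl : ∀ n → (n ℕ.≡ᵇ n) ≡ true
  ≡ᵇ-refl zero    = refl
  ≡ᵇ-refl (suc n) = ≡ᵇ-refl n

  ≡ᵇ-< : ∀ {k n} → k < n → (k ℕ.≡ᵇ n) ≡ false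
  ≡ᵇ-< {zero}  {suc zero}    _         = refl
  ≡ᵇ-< {zero}  {suc (suc n)} _         = refl
  ≡ᵇ-< {suc k} {suc n}       (s≤s k<n) = ≡ᵇ-< k<n

  sqrtUpTo-stable : ∀ n k → k ≤ n → sqrtUpTo n k ≡ W k
  sqrtUpTo-stable zero    zero z≤n = refl
  sqrtUpTo-stable (suc n) k k≤1+n with ℕ.m≤n⇒m<n∨m≡n k≤1+n
  ... | inj₂ refl = refl
  ... | inj₁ k<1+n rewrite ≡ᵇ-< k<1+n = sqrtUpTo-stable n k (ℕ.≤-pred k<1+n)

  sumFrom1-suc : ∀ m (f : ℕ → ℚ) → sumFrom1 (suc m) f ≡ sumTo m (λ i → f (suc i))
  sumFrom1-suc zero    f = ℚ.+-identityˡ (f 1)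
  sumFrom1-suc (suc m) f = cong (_+ f (suc (suc m))) (sumFrom1-suc m f)

  W-suc-suc : ∀ m → W (suc (suc m)) ≡ ½ * (P (suc (suc m)) - sumTo m (λ i → W (suc i) * W (suc (m ∸ i))))
  W-suc-suc m = trans (W-unfold (suc m)) (cong (λ s → ½ * (P (suc (suc m)) - s))
    (trans (sumFrom1-suc m _) (sumTo-cong m λ i i≤m → cong₂ _*_
      (sqrtUpTo-stable (suc m) (suc i) (s≤s i≤m))
      (trans (cong (sqrtUpTo (suc m)) (ℕ.+-∸-assoc 1 i≤m))
             (sqrtUpTo-stable (suc m) (suc (m ∸ i)) (s≤s (ℕ.m∸n≤m m i)))))))
    where
    W-unfold : ∀ n → W (suc n) ≡ ½ * (P (suc n) - sumFrom1 n (λ i → sqrtUpTo n i * sqrtUpTo n (suc n ∸ i)))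
    W-unfold n rewrite ≡ᵇ-refl n = refl

  -- Unfolding gives r₁ k = ½ ((0 - one k) - W (k + 1)), as [z^(k+1)] z = one k.
  W-suc : ∀ k → W (suc k) ≡ - (one k + fromℕ 2 * r₁ k)
  W-suc k = solve 2 (λ w o → w := :- (o :+ con (fromℕ 2) :* (con ½ :* ((con 0ℚ :- o) :- w)))) refl
    (W (suc k)) (one k)

  W-product-sum : ∀ m → sumTo m (λ i → W (suc i) * W (suc (m ∸ i)))
                      ≡ (one m + fromℕ 4 * (r₁ ⊛ r₁) m) + fromℕ 2 * (r₁ m + r₁ m)
  W-product-sum m = begin
    sumTo m (λ i → W (suc i) * W (suc (m ∸ i)))
      ≡⟨ sumTo-cong m (λ i _ → cong₂ _*_ (W-suc i) (W-suc (m ∸ i))) ⟩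
    sumTo m (λ i → (- (one i + two * r₁ i)) * (- (one (m ∸ i) + two * r₁ (m ∸ i))))
      ≡⟨ sumTo-cong m (λ i _ → expand (one i) (r₁ i) (one (m ∸ i)) (r₁ (m ∸ i))) ⟩
    sumTo m (λ i → (one i * one (m ∸ i) + four * (r₁ i * r₁ (m ∸ i)))
                   + two * (one i * r₁ (m ∸ i) + r₁ i * one (m ∸ i)))
      ≡⟨ trans (sumTo-+ m _ _) (cong₂ _+_ (trans (sumTo-+ m _ _) (cong ((one ⊛ one) m +_) (sumTo-*ˡ m four _)))
                                          (trans (sumTo-*ˡ m two _) (cong (two *_) (sumTo-+ m _ _)))) ⟩
    ((one ⊛ one) m + four * (r₁ ⊛ r₁) m) + two * ((one ⊛ r₁) m + (r₁ ⊛ one) m)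
      ≡⟨ cong₂ (λ a b → (a + four * (r₁ ⊛ r₁) m) + two * b)
               (⊛-identityˡ one m) (cong₂ _+_ (⊛-identityˡ r₁ m) (⊛-identityʳ r₁ m)) ⟩
    (one m + four * (r₁ ⊛ r₁) m) + two * (r₁ m + r₁ m) ∎
    where
    open ≡-Reasoning
    two four : ℚ
    two  = fromℕ 2
    four = fromℕ 4
    expand : ∀ a b c d → (- (a + two * b)) * (- (c + two * d)) ≡ (a * c + four * (b * d)) + two * (a * d + b * c)
    expand = solve 4 (λ a b c d → (:- (a :+ con (fromℕ 2) :* b)) :* (:- (c :+ con (fromℕ 2) :* d))
                       := (a :* c :+ con (fromℕ 4) :* (b :* d)) :+ con (fromℕ 2) :* (a :* d :+ b :* c)) refl

  P-suc-suc : ∀ m → P (suc (suc m)) ≡ ((0ℚ - fromℕ 2 * 0ℚ) + one m) - fromℕ 4 * zS m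
  P-suc-suc m = cong₂ (λ a b → ((0ℚ - fromℕ 2 * 0ℚ) + a) - fromℕ 4 * b)
    (pow-zS 2 (suc (suc m)))
    (trans (pow-zS 3 (suc (suc m))) (sym (trans (sym (⊛-identityʳ zS m)) (zS-⊛ one m))))

  -- Coefficientwise form of r₁ = z (z + r₁ + r₁²), the quadratic equation solved by r₁.
  r₁-suc : ∀ m → r₁ (suc m) ≡ zS m + r₁ m + (r₁ ⊛ r₁) m
  r₁-suc m = begin
    r₁ (suc m)
      ≡⟨⟩
    ½ * ((0ℚ - 0ℚ) - W (suc (suc m)))
      ≡⟨ cong (λ w → ½ * ((0ℚ - 0ℚ) - w)) (W-suc-suc m) ⟩
    ½ * ((0ℚ - 0ℚ) - ½ * (P (suc (suc m)) - sumTo m (λ i → W (suc i) * W (suc (m ∸ i)))))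
      ≡⟨ cong₂ (λ p s → ½ * ((0ℚ - 0ℚ) - ½ * (p - s))) (P-suc-suc m) (W-product-sum m) ⟩
    ½ * ((0ℚ - 0ℚ) - ½ * ((((0ℚ - fromℕ 2 * 0ℚ) + one m) - fromℕ 4 * zS m)
                          - ((one m + fromℕ 4 * (r₁ ⊛ r₁) m) + fromℕ 2 * (r₁ m + r₁ m))))
      ≡⟨ solve 4 (λ o z r rr →
           con ½ :* ((con 0ℚ :- con 0ℚ)
                     :- con ½ :* ((((con 0ℚ :- con (fromℕ 2) :* con 0ℚ) :+ o) :- con (fromℕ 4) :* z)
                                  :- ((o :+ con (fromℕ 4) :* rr) :+ con (fromℕ 2) :* (r :+ r))))
           := z :+ r :+ rr) refl (one m) (zS m) (r₁ m) ((r₁ ⊛ r₁) m) ⟩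
    zS m + r₁ m + (r₁ ⊛ r₁) m ∎
    where open ≡-Reasoning

  pow-r₁-vanishes : ∀ k n → n < k ℕ.* 2 → pow r₁ k n ≡ 0ℚ
  pow-r₁-vanishes = pow-vanishes 2 λ where
    zero          _              → refl
    (suc zero)    _              → refl
    (suc (suc _)) (s≤s (s≤s ()))

  pow-r₁-suc : ∀ k t → pow r₁ (suc k) (suc t)
                       ≡ shift₁ (pow r₁ k) t + pow r₁ (suc k) t + pow r₁ (suc (suc k)) t
  pow-r₁-suc k t = begin
    pow r₁ (suc k) (suc t)
      ≡⟨ sumTo-suc t _ ⟩
    r₁ 0 * R (suc t) + sumTo t (λ i → r₁ (suc i) * R (t ∸ i))
      ≡⟨ cong₂ _+_ (ℚ.*-zeroˡ (R (suc t))) (sumTo-cong t (λ i _ → cong (_* R (t ∸ i)) (r₁-suc i))) ⟩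
    0ℚ + (((zS ⊕ r₁) ⊕ (r₁ ⊛ r₁)) ⊛ R) t
      ≡⟨ ℚ.+-identityˡ _ ⟩
    (((zS ⊕ r₁) ⊕ (r₁ ⊛ r₁)) ⊛ R) t
      ≡⟨ ⊛-distribʳ-⊕ (zS ⊕ r₁) (r₁ ⊛ r₁) R t ⟩
    ((zS ⊕ r₁) ⊛ R) t + ((r₁ ⊛ r₁) ⊛ R) t
      ≡⟨ cong₂ _+_ (⊛-distribʳ-⊕ zS r₁ R t) (⊛-assoc r₁ r₁ R t) ⟩
    (zS ⊛ R) t + (r₁ ⊛ R) t + (r₁ ⊛ (r₁ ⊛ R)) t
      ≡⟨ cong (λ x → x + (r₁ ⊛ R) t + (r₁ ⊛ (r₁ ⊛ R)) t) (zS-⊛ R t) ⟩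
    shift₁ R t + pow r₁ (suc k) t + pow r₁ (suc (suc k)) t ∎
    where
    open ≡-Reasoning
    R : Series
    R = pow r₁ k

module Automaton where

  open import Data.Bool using (Bool; false; _∧_; not)
  open import Data.Bool.Properties using (∧-zeroʳ)
  open import Data.Integer as ℤ using (+_; 0ℤ)
  import Data.Integer.Properties as ℤ
  open import Data.List using (List; []; _∷_; foldl; map; inits)
  open import Relation.Nullary.Decidable using (⌊_⌋; isYes≗does)

  -- at h l: the word read so far is admissible, ends at height h and with the letter l.
  data State : Set where
    dead : State
    at   : ℕ → Step → State

  step : State → Step → State
  step dead         _ = dead
  step (at h _)     U = at (suc h) U
  step (at h _)     H = at h H
  step (at h U)     D = dead
  step (at h D)     D = dead
  step (at zero H)  D = dead
  step (at (suc h) H) D = at h D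

  -- A virtual leading H creates neither UD nor DD.
  run : List Step → State
  run = foldl step (at 0 H)

  endsAt : ℕ → State → Bool
  endsAt j dead     = false
  endsAt j (at h _) = h ℕ.≡ᵇ j

  nonnegFrom : ℕ → List Step → Bool
  nonnegFrom h w = allB (λ p → 0ℤ ℤ.≤ᵇ + h ℤ.+ level p) (inits w)

  avoids : Step → List Step → Bool
  avoids l w = not (containsPair U D (l ∷ w)) ∧ not (containsPair D D (l ∷ w))

  accepts : ℕ → Step → List Step → ℕ → Bool
  accepts h l w j = (nonnegFrom h w ∧ avoids l w) ∧ ⌊ + h ℤ.+ level w ℤ.≟ + j ⌋

  allB-cong : ∀ {A : Set} {p q : A → Bool} xs → (∀ x → p x ≡ q x) → allB p xs ≡ allB q xs
  allB-cong []       p≡q = refl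
  allB-cong (x ∷ xs) p≡q = cong₂ _∧_ (p≡q x) (allB-cong xs p≡q)

  allB-map : ∀ {A B : Set} (p : B → Bool) (f : A → B) xs → allB p (map f xs) ≡ allB (λ x → p (f x)) xs
  allB-map p f []       = refl
  allB-map p f (x ∷ xs) = cong (p (f x) ∧_) (allB-map p f xs)

  level-∷ : ∀ {h h′} a → + h ℤ.+ height a ≡ + h′ → ∀ w → + h ℤ.+ level (a ∷ w) ≡ + h′ ℤ.+ level w
  level-∷ {h} a eq w = trans (sym (ℤ.+-assoc (+ h) (height a) (level w))) (cong (ℤ._+ level w) eq)

  nonnegFrom-∷ : ∀ {h h′} a w → + h ℤ.+ height a ≡ + h′ → nonnegFrom h (a ∷ w) ≡ nonnegFrom h′ w
  nonnegFrom-∷ a w eq = trans (allB-map _ (a ∷_) (inits w))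
    (allB-cong (inits w) (λ p → cong (0ℤ ℤ.≤ᵇ_) (level-∷ a eq p)))

  avoids-∷ : ∀ l {a} w → eqStep a D ≡ false → avoids l (a ∷ w) ≡ avoids a w
  avoids-∷ U w a≢D rewrite a≢D = refl
  avoids-∷ H w a≢D = refl
  avoids-∷ D w a≢D rewrite a≢D = refl

  accepts-∷ : ∀ {h h′} l a w j → + h ℤ.+ height a ≡ + h′ → avoids l (a ∷ w) ≡ avoids a w →
              accepts h′ a w j ≡ accepts h l (a ∷ w) j
  accepts-∷ l a w j eq avoids≡ = cong₂ _∧_
    (cong₂ _∧_ (sym (nonnegFrom-∷ a w eq)) (sym avoids≡))
    (cong (λ z → ⌊ z ℤ.≟ + j ⌋) (sym (level-∷ a eq w)))

  accepts-rejected : ∀ h l w j → avoids l w ≡ false → accepts h l w j ≡ false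
  accepts-rejected h l w j avoids≡false rewrite avoids≡false | ∧-zeroʳ (nonnegFrom h w) = refl

  run-dead : ∀ w → foldl step dead w ≡ dead
  run-dead []      = refl
  run-dead (_ ∷ w) = run-dead w

  endsAt-foldl : ∀ h l w j → endsAt j (foldl step (at h l) w) ≡ accepts h l w j
  endsAt-foldl h l []            j = sym (trans (cong (λ z → ⌊ z ℤ.≟ + j ⌋) (ℤ.+-identityʳ (+ h)))
                                                (isYes≗does (+ h ℤ.≟ + j)))
  endsAt-foldl h l (U ∷ w)       j = trans (endsAt-foldl (suc h) U w j)
                                           (accepts-∷ l U w j (cong +_ (ℕ.+-comm h 1)) (avoids-∷ l w refl))
  endsAt-foldl h l (H ∷ w)       j = trans (endsAt-foldl h H w j)
                                           (accepts-∷ l H w j (ℤ.+-identityʳ (+ h)) (avoids-∷ l w refl))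
  endsAt-foldl h U (D ∷ w)       j = trans (cong (endsAt j) (run-dead w)) (sym (accepts-rejected h U (D ∷ w) j refl))
  endsAt-foldl h D (D ∷ w)       j = trans (cong (endsAt j) (run-dead w))
                                           (sym (accepts-rejected h D (D ∷ w) j (∧-zeroʳ _)))
  endsAt-foldl zero H (D ∷ w)    j = cong (endsAt j) (run-dead w)
  endsAt-foldl (suc h) H (D ∷ w) j = trans (endsAt-foldl h D w j) (accepts-∷ H D w j refl refl)

  accepts-start : ∀ w j → accepts 0 H w j ≡ (inM w ∧ ⌊ level w ℤ.≟ + j ⌋)
  accepts-start w j = cong₂ _∧_
    (cong₂ _∧_ (allB-cong (inits w) (λ p → cong (0ℤ ℤ.≤ᵇ_) (ℤ.+-identityˡ (level p)))) (avoids-H w))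
    (cong (λ z → ⌊ z ℤ.≟ + j ⌋) (ℤ.+-identityˡ (level w)))
    where
    avoids-H : ∀ w → avoids H w ≡ (not (containsPair U D w) ∧ not (containsPair D D w))
    avoids-H []      = refl
    avoids-H (_ ∷ _) = refl

  endsAt-run : ∀ w j → endsAt j (run w) ≡ (inM w ∧ ⌊ level w ℤ.≟ + j ⌋)
  endsAt-run w j = trans (endsAt-foldl 0 H w j) (accepts-start w j)

module Counting where

  open import Data.Bool using (Bool; true; false; if_then_else_)
  open import Data.Bool.Properties using (T?)
  open import Data.List using (List; []; _∷_; _∷ʳ_; _++_; filter; length; concatMap)
  import Data.List.Properties as List
  open import Data.Nat.Solver using (module +-*-Solver)
  open +-*-Solver using (solve; _:+_; _:=_)
  open import Data.Nat using (_+_)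
  open Automaton

  countIn : (List Step → Bool) → List (List Step) → ℕ
  countIn p ws = length (filter (λ w → T? (p w)) ws)

  countIn-∷ : ∀ p w ws → countIn p (w ∷ ws) ≡ (if p w then 1 else 0) + countIn p ws
  countIn-∷ p w ws with p w
  ... | true  = refl
  ... | false = refl

  countIn-cong : ∀ {p q} ws → (∀ w → p w ≡ q w) → countIn p ws ≡ countIn q ws
  countIn-cong {p} {q} []       p≡q = refl
  countIn-cong {p} {q} (w ∷ ws) p≡q = begin
    countIn p (w ∷ ws)                    ≡⟨ countIn-∷ p w ws ⟩
    (if p w then 1 else 0) + countIn p ws ≡⟨ cong₂ _+_ (cong (if_then 1 else 0) (p≡q w)) (countIn-cong ws p≡q) ⟩
    (if q w then 1 else 0) + countIn q ws ≡⟨ countIn-∷ q w ws ⟨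
    countIn q (w ∷ ws)                    ∎
    where open ≡-Reasoning

  countIn-false : ∀ ws → countIn (λ _ → false) ws ≡ 0
  countIn-false []       = refl
  countIn-false (_ ∷ ws) = countIn-false ws

  Σ-Step : (Step → ℕ) → ℕ
  Σ-Step f = f U + f H + f D

  Σ-Step-cong : ∀ {f g} → (∀ a → f a ≡ g a) → Σ-Step f ≡ Σ-Step g
  Σ-Step-cong f≡g = cong₂ _+_ (cong₂ _+_ (f≡g U) (f≡g H)) (f≡g D)

  Σ-Step-+ : ∀ f g → Σ-Step (λ a → f a + g a) ≡ Σ-Step f + Σ-Step g
  Σ-Step-+ f g = solve 6 (λ a b c d e f → (a :+ d) :+ (b :+ e) :+ (c :+ f) := (a :+ b :+ c) :+ (d :+ e :+ f)) refl
    (f U) (f H) (f D) (g U) (g H) (g D)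

  Σ-Step-swap : ∀ (f : Step → Step → ℕ) →
                Σ-Step (λ a → Σ-Step (f a)) ≡ Σ-Step (λ b → Σ-Step (λ a → f a b))
  Σ-Step-swap f = trans (Σ-Step-+ (λ a → f a U + f a H) (λ a → f a D))
    (cong (_+ Σ-Step (λ a → f a D)) (Σ-Step-+ (λ a → f a U) (λ a → f a H)))

  consEach : List Step → List (List Step)
  consEach w = (U ∷ w) ∷ (H ∷ w) ∷ (D ∷ w) ∷ []

  countIn-concatMap-consEach : ∀ p ws →
    countIn p (concatMap consEach ws) ≡ Σ-Step (λ a → countIn (λ w → p (a ∷ w)) ws)
  countIn-concatMap-consEach p []       = refl
  countIn-concatMap-consEach p (w ∷ ws) = begin
    countIn p (consEach w ++ concatMap consEach ws)
      ≡⟨ trans (countIn-∷ p _ _)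
           (cong (here U +_) (trans (countIn-∷ p _ _) (cong (here H +_) (countIn-∷ p _ _)))) ⟩
    here U + (here H + (here D + countIn p (concatMap consEach ws)))
      ≡⟨ cong (λ t → here U + (here H + (here D + t))) (countIn-concatMap-consEach p ws) ⟩
    here U + (here H + (here D + Σ-Step there))
      ≡⟨ solve 6 (λ a b c d e f → a :+ (b :+ (c :+ (d :+ e :+ f))) := (a :+ d) :+ (b :+ e) :+ (c :+ f)) refl
           (here U) (here H) (here D) (there U) (there H) (there D) ⟩
    Σ-Step (λ a → here a + there a)
      ≡⟨ Σ-Step-cong (λ a → countIn-∷ (λ v → p (a ∷ v)) w ws) ⟨
    Σ-Step (λ a → countIn (λ v → p (a ∷ v)) (w ∷ ws)) ∎
    where
    open ≡-Reasoning
    here there : Step → ℕ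
    here  a = if p (a ∷ w) then 1 else 0
    there a = countIn (λ v → p (a ∷ v)) ws

  countIn-words-∷ʳ : ∀ n p →
    countIn p (words (suc n)) ≡ Σ-Step (λ a → countIn (λ w → p (w ∷ʳ a)) (words n))
  countIn-words-∷ʳ zero    p = trans (countIn-concatMap-consEach p ([] ∷ []))
    (Σ-Step-cong (λ a → trans (countIn-∷ (λ w → p (a ∷ w)) [] [])
                              (sym (countIn-∷ (λ w → p (w ∷ʳ a)) [] []))))
  countIn-words-∷ʳ (suc n) p = begin
    countIn p (words (suc (suc n)))
      ≡⟨ countIn-concatMap-consEach p (words (suc n)) ⟩
    Σ-Step (λ a → countIn (λ w → p (a ∷ w)) (words (suc n)))
      ≡⟨ Σ-Step-cong (λ a → countIn-words-∷ʳ n (λ w → p (a ∷ w))) ⟩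
    Σ-Step (λ a → Σ-Step (λ b → countIn (λ w → p (a ∷ (w ∷ʳ b))) (words n)))
      ≡⟨ Σ-Step-swap (λ a b → countIn (λ w → p (a ∷ (w ∷ʳ b))) (words n)) ⟩
    Σ-Step (λ b → Σ-Step (λ a → countIn (λ w → p (a ∷ (w ∷ʳ b))) (words n)))
      ≡⟨ Σ-Step-cong (λ b → countIn-concatMap-consEach (λ w → p (w ∷ʳ b)) (words n)) ⟨
    Σ-Step (λ b → countIn (λ w → p (w ∷ʳ b)) (words (suc n))) ∎
    where open ≡-Reasoning

  countRuns : ℕ → (State → Bool) → ℕ
  countRuns n q = countIn (λ w → q (run w)) (words n)

  countRuns-cong : ∀ n {q q′} → (∀ s → q s ≡ q′ s) → countRuns n q ≡ countRuns n q′
  countRuns-cong n q≡q′ = countIn-cong (words n) (λ w → q≡q′ (run w))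

  countRuns-suc : ∀ n q → countRuns (suc n) q ≡ Σ-Step (λ a → countRuns n (λ s → q (step s a)))
  countRuns-suc n q = trans (countIn-words-∷ʳ n (λ w → q (run w)))
    (Σ-Step-cong (λ a → countIn-cong (words n) (λ w → cong q (List.foldl-∷ʳ step (at 0 H) a w))))

  count≡countRuns : ∀ n j → count n j ≡ countRuns n (endsAt j)
  count≡countRuns n j = countIn-cong (words n) (λ w → sym (endsAt-run w j))

  -- The words of 𝓜 of length n + 1 and level j ending in U, resp. in D; since a D
  -- is always preceded by an H, the latter are the words of length n - 1 and level j + 1 followed by HD.
  countEndingU : ℕ → ℕ → ℕ
  countEndingU n zero    = 0
  countEndingU n (suc j) = count n j

  countEndingD : ℕ → ℕ → ℕ
  countEndingD zero    j = 0
  countEndingD (suc n) j = count n (suc j)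

  countRuns-U : ∀ n j → countRuns n (λ s → endsAt j (step s U)) ≡ countEndingU n j
  countRuns-U n zero    = trans (countRuns-cong n U-zero) (countIn-false (words n))
    where
    U-zero : ∀ s → endsAt 0 (step s U) ≡ false
    U-zero dead     = refl
    U-zero (at _ _) = refl
  countRuns-U n (suc j) = trans (countRuns-cong n U-suc) (sym (count≡countRuns n j))
    where
    U-suc : ∀ s → endsAt (suc j) (step s U) ≡ endsAt j s
    U-suc dead     = refl
    U-suc (at _ _) = refl

  countRuns-H : ∀ n j → countRuns n (λ s → endsAt j (step s H)) ≡ count n j
  countRuns-H n j = trans (countRuns-cong n H-same) (sym (count≡countRuns n j))
    where
    H-same : ∀ s → endsAt j (step s H) ≡ endsAt j s
    H-same dead     = refl
    H-same (at _ _) = refl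

  countRuns-D : ∀ n j → countRuns n (λ s → endsAt j (step s D)) ≡ countEndingD n j
  countRuns-D zero    j = refl
  countRuns-D (suc n) j = begin
    countRuns (suc n) (λ s → endsAt j (step s D))
      ≡⟨ countRuns-suc n (λ s → endsAt j (step s D)) ⟩
    Σ-Step (λ a → countRuns n (λ s → endsAt j (step (step s a) D)))
      ≡⟨ cong₂ _+_ (cong₂ _+_ (trans (countRuns-cong n UD-dead) (countIn-false (words n)))
                              (countRuns-cong n HD-down))
                   (trans (countRuns-cong n DD-dead) (countIn-false (words n))) ⟩
    0 + countRuns n (endsAt (suc j)) + 0
      ≡⟨ ℕ.+-identityʳ _ ⟩
    countRuns n (endsAt (suc j))
      ≡⟨ count≡countRuns n (suc j) ⟨
    count n (suc j) ∎
    where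
    open ≡-Reasoning
    UD-dead : ∀ s → endsAt j (step (step s U) D) ≡ false
    UD-dead dead     = refl
    UD-dead (at _ _) = refl
    HD-down : ∀ s → endsAt j (step (step s H) D) ≡ endsAt (suc j) s
    HD-down dead           = refl
    HD-down (at zero _)    = refl
    HD-down (at (suc _) _) = refl
    DD-dead : ∀ s → endsAt j (step (step s D) D) ≡ false
    DD-dead dead           = refl
    DD-dead (at _ U)       = refl
    DD-dead (at _ D)       = refl
    DD-dead (at zero H)    = refl
    DD-dead (at (suc _) H) = refl

  count-suc : ∀ n j → count (suc n) j ≡ countEndingU n j + count n j + countEndingD n j
  count-suc n j = begin
    count (suc n) j
      ≡⟨ count≡countRuns (suc n) j ⟩
    countRuns (suc n) (endsAt j)
      ≡⟨ countRuns-suc n (endsAt j) ⟩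
    Σ-Step (λ a → countRuns n (λ s → endsAt j (step s a)))
      ≡⟨ cong₂ _+_ (cong₂ _+_ (countRuns-U n j) (countRuns-H n j)) (countRuns-D n j) ⟩
    countEndingU n j + count n j + countEndingD n j ∎
    where open ≡-Reasoning

module Coefficients where

  open import Data.Rational using (ℚ; mkℚ; 0ℚ; _+_; _*_; _-_; -_; _/_)
  import Data.Rational.Properties as ℚ
  open import Data.Nat.Coprimality using (1-coprimeTo) renaming (sym to coprime-sym)
  import Data.Integer as ℤ
  import Data.Integer.Properties as ℤ
  open import Relation.Binary.Reasoning.Setoid (ℕ →-setoid ℚ) using () renaming
    (begin_ to begin≗_; step-≈-⟩ to step-≗-⟩; step-≈-⟨ to step-≗-⟨; _∎ to _∎≗)
  open SeriesAlgebra
  open SeriesR₁ using (pow-r₁-vanishes; pow-r₁-suc)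
  open Counting using (countEndingU; countEndingD; count-suc)

  fromℕ-+ : ∀ a b → fromℕ (a ℕ.+ b) ≡ fromℕ a + fromℕ b
  fromℕ-+ a b = trans (cong (_/ 1) (cong₂ ℤ._+_ (sym (ℤ.*-identityʳ (ℤ.+ a))) (sym (ℤ.*-identityʳ (ℤ.+ b)))))
                      (cong₂ _+_ (sym (fromℕ≡mkℚ a)) (sym (fromℕ≡mkℚ b)))
    where
    fromℕ≡mkℚ : ∀ n → fromℕ n ≡ mkℚ (ℤ.+ n) 0 (coprime-sym (1-coprimeTo n))
    fromℕ≡mkℚ n = ℚ.normalize-coprime (coprime-sym (1-coprimeTo n))

  pow-r₁-coefficient : ∀ m j → pow r₁ (suc j) (suc (suc (j ℕ.+ m))) ≡ fromℕ (count m j)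
  pow-r₁-coefficient zero    zero    = refl
  pow-r₁-coefficient zero    (suc j) =
    trans (cong (λ t → pow r₁ (suc (suc j)) (suc (suc t))) (ℕ.+-identityʳ (suc j)))
    (pow-r₁-vanishes (suc (suc j)) (suc (suc (suc j))) (s≤s (s≤s (s≤s (s≤s (ℕ.m≤m*n j 2))))))
  pow-r₁-coefficient (suc m) j = begin
    pow r₁ (suc j) (suc (suc (j ℕ.+ suc m)))
      ≡⟨ cong (λ t → pow r₁ (suc j) (suc (suc t))) (ℕ.+-suc j m) ⟩
    pow r₁ (suc j) (suc (suc (suc (j ℕ.+ m))))
      ≡⟨ pow-r₁-suc j (suc (suc (j ℕ.+ m))) ⟩
    shift₁ (pow r₁ j) t + pow r₁ (suc j) t + pow r₁ (suc (suc j)) t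
      ≡⟨ cong₂ _+_ (cong₂ _+_ (endingU j) (pow-r₁-coefficient m j)) (endingD m) ⟩
    fromℕ (countEndingU m j) + fromℕ (count m j) + fromℕ (countEndingD m j)
      ≡⟨ trans (fromℕ-+ (countEndingU m j ℕ.+ count m j) _)
               (cong (_+ fromℕ (countEndingD m j)) (fromℕ-+ (countEndingU m j) (count m j))) ⟨
    fromℕ (countEndingU m j ℕ.+ count m j ℕ.+ countEndingD m j)
      ≡⟨ cong fromℕ (count-suc m j) ⟨
    fromℕ (count (suc m) j) ∎
    where
    open ≡-Reasoning
    t : ℕ
    t = suc (suc (j ℕ.+ m))
    endingU : ∀ j → shift₁ (pow r₁ j) (suc (suc (j ℕ.+ m))) ≡ fromℕ (countEndingU m j)
    endingU zero    = refl
    endingU (suc j) = pow-r₁-coefficient m j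
    endingD : ∀ m → pow r₁ (suc (suc j)) (suc (suc (j ℕ.+ m))) ≡ fromℕ (countEndingD m j)
    endingD zero     = trans (cong (λ t → pow r₁ (suc (suc j)) (suc (suc t))) (ℕ.+-identityʳ j))
      (pow-r₁-vanishes (suc (suc j)) (suc (suc j)) (s≤s (s≤s (ℕ.m≤n⇒m≤1+n (s≤s (ℕ.m≤m*n j 2))))))
    endingD (suc m′) = trans (cong (λ t → pow r₁ (suc (suc j)) (suc (suc t))) (ℕ.+-suc j m′))
      (pow-r₁-coefficient m′ (suc j))

  S-column : ∀ j → shift (suc (suc j)) (coeffU j S) ≗ pow r₁ (suc j)
  S-column j = shift-unique (suc (suc j))
    (λ n n<j+2 → pow-r₁-vanishes (suc j) n (ℕ.<-≤-trans n<j+2 (s≤s (s≤s (ℕ.m≤m*n j 2)))))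
    (λ m → pow-r₁-coefficient m j)

  column-formula : ∀ j → pow zS (j ℕ.+ 2) ⊛ coeffU j S ≗ pow r₁ (suc j)
  column-formula j n = trans (cong (λ k → (pow zS k ⊛ coeffU j S) n) (ℕ.+-comm j 2))
    (trans (pow-zS-⊛ (suc (suc j)) (coeffU j S) n) (S-column j n))

  S-column-suc : ∀ j → (zS ⊛ zS) ⊛ coeffU (suc j) S ≗ (zS ⊛ r₁) ⊛ coeffU j S
  S-column-suc j = shift-injective k (begin≗
    shift k ((zS ⊛ zS) ⊛ Sⱼ₊₁)   ≈⟨ ⊛-shift k (zS ⊛ zS) Sⱼ₊₁ ⟨
    (zS ⊛ zS) ⊛ shift k Sⱼ₊₁     ≈⟨ ⊛-assoc zS zS (shift k Sⱼ₊₁) ⟩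
    zS ⊛ (zS ⊛ shift k Sⱼ₊₁)     ≈⟨ ⊛-congˡ zS (zS-⊛ (shift k Sⱼ₊₁)) ⟩
    zS ⊛ shift (suc k) Sⱼ₊₁      ≈⟨ ⊛-congˡ zS (S-column (suc j)) ⟩
    zS ⊛ (r₁ ⊛ pow r₁ (suc j))   ≈⟨ ⊛-congˡ zS (⊛-congˡ r₁ (S-column j)) ⟨
    zS ⊛ (r₁ ⊛ shift k Sⱼ)       ≈⟨ ⊛-congˡ zS (⊛-shift k r₁ Sⱼ) ⟩
    zS ⊛ shift k (r₁ ⊛ Sⱼ)       ≈⟨ ⊛-shift k zS (r₁ ⊛ Sⱼ) ⟩
    shift k (zS ⊛ (r₁ ⊛ Sⱼ))     ≈⟨ shift-cong k (⊛-assoc zS r₁ Sⱼ) ⟨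
    shift k ((zS ⊛ r₁) ⊛ Sⱼ)     ∎≗)
    where
    k : ℕ
    k = suc (suc j)
    Sⱼ Sⱼ₊₁ : Series
    Sⱼ   = coeffU j S
    Sⱼ₊₁ = coeffU (suc j) S

  lift-⊛₂ : ∀ f G n j → (lift f ⊛₂ G) n j ≡ (f ⊛ coeffU j G) n
  lift-⊛₂ f G n j = sumTo-cong n (λ a _ → sumTo-head j (λ b → ℚ.*-zeroˡ (G (n ∸ a) (j ∸ suc b))))

  uVar-⊛₂ : ∀ G n j → (uVar ⊛₂ G) n j ≡ shift₁ (G n) j
  uVar-⊛₂ G n j = trans (sumTo-head n (λ a → sumTo-zero j (λ b _ → ℚ.*-zeroˡ (G (n ∸ suc a) (j ∸ b)))))
                        (zS-⊛ (G n) j)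

  ⊛₂-linear-suc : ∀ G F n j → (∀ a b → G a (suc (suc b)) ≡ 0ℚ) →
                  (G ⊛₂ F) n (suc j) ≡ (coeffU 0 G ⊛ coeffU (suc j) F) n + (coeffU 1 G ⊛ coeffU j F) n
  ⊛₂-linear-suc G F n j G-linear = trans
    (sumTo-cong n (λ a _ → trans (sumTo-suc j _) (cong (G a 0 * F (n ∸ a) (suc j) +_)
      (sumTo-head j (λ b → trans (cong (_* F (n ∸ a) (j ∸ suc b)) (G-linear a b))
                                 (ℚ.*-zeroˡ (F (n ∸ a) (j ∸ suc b))))))))
    (sumTo-+ n _ _)

  denomS-column : ∀ b → coeffU b denomS ≗ zS ⊛ (λ c → lift zS c b - shift₁ (lift r₁ c) b)
  denomS-column b a = trans (lift-⊛₂ zS (lift zS ⊖₂ (uVar ⊛₂ lift r₁)) a b)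
    (⊛-congˡ zS (λ c → cong (λ x → lift zS c b - x) (uVar-⊛₂ (lift r₁) c b)) a)

  denomS-column₀ : coeffU 0 denomS ≗ zS ⊛ zS
  denomS-column₀ a = trans (denomS-column 0 a) (⊛-congˡ zS (λ c → ℚ.+-identityʳ (zS c)) a)

  denomS-column₁ : coeffU 1 denomS ≗ zS ⊛ neg r₁
  denomS-column₁ a = trans (denomS-column 1 a) (⊛-congˡ zS (λ c → ℚ.+-identityˡ (- r₁ c)) a)

  denomS-linear : ∀ a b → denomS a (suc (suc b)) ≡ 0ℚ
  denomS-linear a b = trans (denomS-column (suc (suc b)) a) (sumTo-zero a (λ c _ → ℚ.*-zeroʳ (zS c)))

  denominator-identity : ∀ n j → (denomS ⊛₂ S) n j ≡ lift r₁ n j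
  denominator-identity n zero = begin
    (coeffU 0 denomS ⊛ coeffU 0 S) n
      ≡⟨ ⊛-congʳ (coeffU 0 S) denomS-column₀ n ⟩
    ((zS ⊛ zS) ⊛ coeffU 0 S) n
      ≡⟨ ⊛-congʳ (coeffU 0 S) (⊛-congˡ zS (λ c → sym (⊛-identityʳ zS c))) n ⟩
    (pow zS 2 ⊛ coeffU 0 S) n
      ≡⟨ column-formula 0 n ⟩
    (r₁ ⊛ one) n
      ≡⟨ ⊛-identityʳ r₁ n ⟩
    r₁ n ∎
    where open ≡-Reasoning
  denominator-identity n (suc j) = begin
    (denomS ⊛₂ S) n (suc j)
      ≡⟨ ⊛₂-linear-suc denomS S n j denomS-linear ⟩
    (coeffU 0 denomS ⊛ coeffU (suc j) S) n + (coeffU 1 denomS ⊛ coeffU j S) n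
      ≡⟨ cong₂ _+_ (⊛-congʳ (coeffU (suc j) S) denomS-column₀ n) (⊛-congʳ (coeffU j S) denomS-column₁ n) ⟩
    ((zS ⊛ zS) ⊛ coeffU (suc j) S) n + ((zS ⊛ neg r₁) ⊛ coeffU j S) n
      ≡⟨ cong₂ _+_ (S-column-suc j n)
                   (trans (⊛-congʳ (coeffU j S) (⊛-negʳ zS r₁) n) (⊛-negˡ (zS ⊛ r₁) (coeffU j S) n)) ⟩
    ((zS ⊛ r₁) ⊛ coeffU j S) n - ((zS ⊛ r₁) ⊛ coeffU j S) n
      ≡⟨ ℚ.+-inverseʳ (((zS ⊛ r₁) ⊛ coeffU j S) n) ⟩
    0ℚ ∎
    where open ≡-Reasoning

open import Data.Nat using (_+_)
open import Data.Product using (_×_; _,_)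

mainTheorem14 : ((n j : ℕ) → (denomS ⊛₂ S) n j ≡ lift r₁ n j)
                × ((j n : ℕ) → (pow zS (j + 2) ⊛ coeffU j S) n ≡ pow r₁ (suc j) n)
mainTheorem14 = Coefficients.denominator-identity , Coefficients.column-formula
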